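{- Let $p\in(0,1)$, $q=1-p$, and $m\ge 1$. Let $L_m$ be the $(m+1)\times(m+1)$ lower triangular matrix indexed by $0\le i,j\le m$ with $(L_m)_{ij}=\binom{i}{i-j}p^{i-j}q^{j+1}$, and let $P_m$ be the $(m+1)\times(m+1)$ matrix with $(P_m)_{ij}=\binom{m-i}{j-i}$ (which is invertible). Then for all $0\le i,j\le m$, $$(P_m^{ -1}L_mP_m)_{ij}=\binom{i}{j}p^{i-j}q^{m+1-i}.$$
   Context: Binomial coefficients $\binom{a}{b}$ are taken to be $0$ when $b<0$ or $b>a$. Indices of matrices run from $0$ to $m$. The matrix $P_m$ has the eigenvectors of the upper triangular matrix $U_m$, $(U_m)_{ij}=\binom{m-i}{j-i}p^{m+1-j}q^{j-i}$, as its columns. -}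

module Defs where

open import Level using (Level)
open import Data.Nat as ℕ using (ℕ; zero; suc; _≤ᵇ_; _∸_)
open import Data.Nat.Combinatorics using (_C_)
open import Data.Fin using (Fin; toℕ)
open import Data.Bool using (if_then_else_)
open import Algebra.Bundles using (CommutativeRing)

module _ {c ℓ : Level} (R : CommutativeRing c ℓ) where
  open CommutativeRing R

  Mat : ℕ → Set c
  Mat m = Fin (suc m) → Fin (suc m) → Carrier

  fromℕ : ℕ → Carrier
  fromℕ zero = 0#
  fromℕ (suc n) = 1# + fromℕ n

  pow : Carrier → ℕ → Carrier
  pow x zero = 1#
  pow x (suc n) = x * pow x n

  ∑ : {n : ℕ} → (Fin n → Carrier) → Carrier
  ∑ {zero} f = 0#
  ∑ {suc n} f = f Fin.zero + ∑ (λ k → f (Fin.suc k))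


  _⊗_ : {m : ℕ} → Mat m → Mat m → Mat m
  (A ⊗ B) i j = ∑ (λ k → A i k * B k j)

  Id : (m : ℕ) → Mat m
  Id m i j = if toℕ i ℕ.≡ᵇ toℕ j then 1# else 0#

  _≋_ : {m : ℕ} → Mat m → Mat m → Set ℓ
  A ≋ B = ∀ i j → A i j ≈ B i j

  -- binomial coefficient (a choose (b - c)) with the convention that it is 0
  -- when b - c < 0 (i.e. c > b) or b - c > a
  binomDiff : ℕ → ℕ → ℕ → ℕ
  binomDiff a b c = if c ≤ᵇ b then a C (b ∸ c) else 0

  Lmat : (m : ℕ) → Carrier → Carrier → Mat m
  Lmat m p q i j =
    fromℕ (binomDiff (toℕ i) (toℕ i) (toℕ j)) * (pow p (toℕ i ∸ toℕ j) * pow q (suc (toℕ j)))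

  Pmat : (m : ℕ) → Mat m
  Pmat m i j = fromℕ (binomDiff (m ∸ toℕ i) (toℕ j) (toℕ i))

  Tmat : (m : ℕ) → Carrier → Carrier → Mat m
  Tmat m p q i j =
    fromℕ (toℕ i C toℕ j) * (pow p (toℕ i ∸ toℕ j) * pow q (suc m ∸ toℕ i))

{-# OPTIONS --safe #-}
-- Read row i of an (m+1)×(m+1) matrix as a polynomial of degree ≤ m. Row i of P_m is xⁱ (1 + x)^(m-i),
-- and the inverse is the matrix with rows xⁱ (1 - x)^(m-i). Passing from m to m + 1 multiplies every
-- old row of P, P⁻¹, L and T by a fixed linear polynomial a + b x, and the products P P⁻¹, P⁻¹ P,
-- L P and P T inherit such a recurrence, with (a, b) computed from those of the factors. Two families
-- with the same recurrence that agree on each newly added row agree everywhere; this gives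
-- P P⁻¹ = P⁻¹ P = 1 and, using p + q = 1, L P = P T, from which P⁻¹ L P = T.
module Submission where

open import Defs
open import Level using (Level)
open import Algebra.Bundles using (CommutativeRing)
open import Data.Bool using (if_then_else_)
open import Data.Fin as Fin using (Fin; toℕ)
open import Data.Fin.Properties using (toℕ<n; toℕ≤pred[n]; toℕ-inject₁; toℕ-fromℕ)
open import Data.Nat as ℕ using (ℕ; zero; suc; _∸_; _≤_; _<_; _≡ᵇ_; z≤n; s≤s)
import Data.Nat.Properties as ℕₚ
open import Data.Nat.Combinatorics using (_C_; k>n⇒nCk≡0; nCk+nC[k+1]≡[n+1]C[k+1]; nCk≡nC[n∸k])
open import Data.Product using (Σ; _×_; _,_)
open import Data.Sum using (_⊎_; inj₁; inj₂)
open import Relation.Nullary using (yes; no)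
open import Relation.Binary.PropositionalEquality as ≡ using (_≡_)

module _ {c ℓ : Level} (R : CommutativeRing c ℓ) where
  open CommutativeRing R hiding (zero)

  binomDiff-suc-suc : ∀ a b c → binomDiff R a (suc b) (suc c) ≡ binomDiff R a b c
  binomDiff-suc-suc a b zero    = ≡.refl
  binomDiff-suc-suc a b (suc c) = ≡.refl

  binomDiff-≤ : ∀ a {b c} → c ≤ b → binomDiff R a b c ≡ a C (b ∸ c)
  binomDiff-≤ a z≤n = ≡.refl
  binomDiff-≤ a {suc b} {suc c} (s≤s c≤b) = ≡.trans (binomDiff-suc-suc a b c) (binomDiff-≤ a c≤b)

  binomDiff-< : ∀ a {b c} → b < c → binomDiff R a b c ≡ 0
  binomDiff-< a {zero}  {suc c} _         = ≡.refl
  binomDiff-< a {suc b} {suc c} (s≤s b<c) = ≡.trans (binomDiff-suc-suc a b c) (binomDiff-< a b<c)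

  binomDiff-diagonal : ∀ n k → binomDiff R n n k ≡ n C k
  binomDiff-diagonal n k with k ℕₚ.≤? n
  ... | yes k≤n = ≡.trans (binomDiff-≤ n k≤n) (≡.sym (nCk≡nC[n∸k] k≤n))
  ... | no k≰n  =
    ≡.trans (binomDiff-< n (ℕₚ.≰⇒> k≰n)) (≡.sym (k>n⇒nCk≡0 (ℕₚ.≰⇒> k≰n)))

  binomDiff-pascal₀ : ∀ a c → binomDiff R (suc a) 0 c ≡ binomDiff R a 0 c
  binomDiff-pascal₀ a zero    = ≡.refl
  binomDiff-pascal₀ a (suc c) = ≡.refl

  binomDiff-pascal : ∀ a b c →
    binomDiff R (suc a) (suc b) c ≡ binomDiff R a (suc b) c ℕ.+ binomDiff R a b c
  binomDiff-pascal a b zero =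
    ≡.trans (≡.sym (nCk+nC[k+1]≡[n+1]C[k+1] a b)) (ℕₚ.+-comm (a C b) (a C suc b))
  binomDiff-pascal a zero (suc c) = begin
    binomDiff R (suc a) 1 (suc c)  ≡⟨ binomDiff-suc-suc (suc a) 0 c ⟩
    binomDiff R (suc a) 0 c        ≡⟨ binomDiff-pascal₀ a c ⟩
    binomDiff R a 0 c              ≡⟨ binomDiff-suc-suc a 0 c ⟨
    binomDiff R a 1 (suc c)        ≡⟨ ℕₚ.+-identityʳ _ ⟨
    binomDiff R a 1 (suc c) ℕ.+ 0  ∎
    where open ≡.≡-Reasoning
  binomDiff-pascal a (suc b) (suc c) = begin
    binomDiff R (suc a) (suc (suc b)) (suc c)
      ≡⟨ binomDiff-suc-suc (suc a) (suc b) c ⟩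
    binomDiff R (suc a) (suc b) c
      ≡⟨ binomDiff-pascal a b c ⟩
    binomDiff R a (suc b) c ℕ.+ binomDiff R a b c
      ≡⟨ ≡.cong₂ ℕ._+_ (binomDiff-suc-suc a (suc b) c) (binomDiff-suc-suc a b c) ⟨
    binomDiff R a (suc (suc b)) (suc c) ℕ.+ binomDiff R a (suc b) (suc c) ∎
    where open ≡.≡-Reasoning

  open import Algebra.Properties.CommutativeSemigroup *-commutativeSemigroup using (x∙yz≈y∙xz)
  open import Algebra.Properties.Semiring.Sum semiring
    using (sum; sum-cong-≋; ∑-distrib-+; ∑-comm; *-distribˡ-sum; *-distribʳ-sum; sum-init-last; sum-replicate-zero)
  open import Algebra.Solver.Ring.NaturalCoefficients.Default commutativeSemiring
    using (solve; _:+_; _:*_; _:=_)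
  open import Relation.Binary.Reasoning.Setoid setoid

  fromℕ-+ : ∀ a b → fromℕ R (a ℕ.+ b) ≈ fromℕ R a + fromℕ R b
  fromℕ-+ zero    b = sym (+-identityˡ _)
  fromℕ-+ (suc a) b = trans (+-congˡ (fromℕ-+ a b)) (sym (+-assoc 1# _ _))

  pow-1# : ∀ n → pow R 1# n ≈ 1#
  pow-1# zero    = refl
  pow-1# (suc n) = trans (*-identityˡ _) (pow-1# n)

  *-pow-suc : ∀ x y {a b} → a ≡ suc b ⊎ y ≈ 0# → y * pow R x a ≈ x * (y * pow R x b)
  *-pow-suc x y (inj₁ ≡.refl) = x∙yz≈y∙xz y x _
  *-pow-suc x y {a} {b} (inj₂ y≈0) = begin
    y * pow R x a        ≈⟨ *-congʳ y≈0 ⟩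
    0# * pow R x a       ≈⟨ zeroˡ _ ⟩
    0#                   ≈⟨ zeroʳ x ⟨
    x * 0#               ≈⟨ *-congˡ (trans (*-congʳ y≈0) (zeroˡ _)) ⟨
    x * (y * pow R x b)  ∎

  δ : ℕ → ℕ → Carrier
  δ i j = if i ≡ᵇ j then 1# else 0#

  -- A row f stands for the polynomial Σⱼ f j xʲ; shift multiplies it by x and mulLinear a b by a + b x.
  Row : Set c
  Row = ℕ → Carrier

  shift : Row → Row
  shift f zero    = 0#
  shift f (suc j) = f j

  mulLinear : Carrier → Carrier → Row → Row
  mulLinear a b f j = a * f j + b * shift f j

  shift-cong : ∀ {f g : Row} → (∀ j → f j ≈ g j) → ∀ j → shift f j ≈ shift g j
  shift-cong f≈g zero    = refl
  shift-cong f≈g (suc j) = f≈g j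

  mulLinear-cong : ∀ {a a′ b b′} {f g : Row} → a ≈ a′ → b ≈ b′ → (∀ j → f j ≈ g j) →
                   ∀ j → mulLinear a b f j ≈ mulLinear a′ b′ g j
  mulLinear-cong a≈a′ b≈b′ f≈g j = +-cong (*-cong a≈a′ (f≈g j)) (*-cong b≈b′ (shift-cong f≈g j))

  mulLinear-identity : ∀ (f : Row) j → mulLinear 1# 0# f j ≈ f j
  mulLinear-identity f j = trans (+-cong (*-identityˡ (f j)) (zeroˡ _)) (+-identityʳ (f j))

  mulLinear-x : ∀ (f : Row) j → mulLinear 0# 1# f j ≈ shift f j
  mulLinear-x f j = trans (+-cong (zeroˡ (f j)) (*-identityˡ (shift f j))) (+-identityˡ _)

  linear-*ʳ : ∀ a b x y w → (a * x + b * y) * w ≈ a * (x * w) + b * (y * w)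
  linear-*ʳ = solve 5 (λ a b x y w → (a :* x :+ b :* y) :* w := a :* (x :* w) :+ b :* (y :* w)) refl

  *-linear : ∀ a b x y w → w * (a * x + b * y) ≈ a * (w * x) + b * (w * y)
  *-linear = solve 5 (λ a b x y w → w :* (a :* x :+ b :* y) := a :* (w :* x) :+ b :* (w :* y)) refl

  mulLinear-combination : ∀ a₁ a₂ a₃ a₄ a₅ a₆ (h : Row) j →
    a₁ * mulLinear a₃ a₄ h j + a₂ * mulLinear a₅ a₆ h j ≈
    mulLinear (a₁ * a₃ + a₂ * a₅) (a₁ * a₄ + a₂ * a₆) h j
  mulLinear-combination a₁ a₂ a₃ a₄ a₅ a₆ h j =
    solve 8 (λ a₁ a₂ a₃ a₄ a₅ a₆ x y →
      a₁ :* (a₃ :* x :+ a₄ :* y) :+ a₂ :* (a₅ :* x :+ a₆ :* y) :=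
      (a₁ :* a₃ :+ a₂ :* a₅) :* x :+ (a₁ :* a₄ :+ a₂ :* a₆) :* y)
      refl a₁ a₂ a₃ a₄ a₅ a₆ (h j) (shift h j)

  -- Multiplying the coefficients by a geometric sequence w is the substitution x ↦ c x.
  mulLinear-*-geometric : ∀ a b c (f w : Row) → (∀ j → w (suc j) ≈ c * w j) →
    ∀ j → mulLinear a b f j * w j ≈ mulLinear a (b * c) (λ j → f j * w j) j
  mulLinear-*-geometric a b c f w w-suc zero = begin
    (a * f 0 + b * 0#) * w 0
      ≈⟨ linear-*ʳ a b (f 0) 0# (w 0) ⟩
    a * (f 0 * w 0) + b * (0# * w 0)
      ≈⟨ +-congˡ (trans (*-congˡ (zeroˡ _)) (trans (zeroʳ b) (sym (zeroʳ _)))) ⟩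
    a * (f 0 * w 0) + b * c * 0# ∎
  mulLinear-*-geometric a b c f w w-suc (suc j) = begin
    (a * f (suc j) + b * f j) * w (suc j)
      ≈⟨ linear-*ʳ a b (f (suc j)) (f j) (w (suc j)) ⟩
    a * (f (suc j) * w (suc j)) + b * (f j * w (suc j))
      ≈⟨ +-congˡ (*-congˡ (*-congˡ (w-suc j))) ⟩
    a * (f (suc j) * w (suc j)) + b * (f j * (c * w j))
      ≈⟨ +-congˡ (solve 4 (λ b c y z → b :* (y :* (c :* z)) := (b :* c) :* (y :* z)) refl b c (f j) (w j)) ⟩
    a * (f (suc j) * w (suc j)) + b * c * (f j * w j) ∎

  sumTo : ℕ → Row → Carrier
  sumTo n f = sum {n} (λ k → f (toℕ k))

  sumTo-cong : ∀ n {f g : Row} → (∀ k → k < n → f k ≈ g k) → sumTo n f ≈ sumTo n g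
  sumTo-cong n f≈g = sum-cong-≋ {n} (λ k → f≈g (toℕ k) (toℕ<n k))

  sumTo-linear : ∀ n a b (f g : Row) →
    sumTo n (λ k → a * f k + b * g k) ≈ a * sumTo n f + b * sumTo n g
  sumTo-linear n a b f g =
    trans (∑-distrib-+ {n} (λ k → a * f (toℕ k)) (λ k → b * g (toℕ k)))
          (+-cong (sym (*-distribˡ-sum {n} a (λ k → f (toℕ k))))
                  (sym (*-distribˡ-sum {n} b (λ k → g (toℕ k)))))

  sumTo-last-zero : ∀ n (f : Row) → f n ≈ 0# → sumTo (suc n) f ≈ sumTo n f
  sumTo-last-zero n f fn≈0 = begin
    sumTo (suc n) f
      ≈⟨ sum-init-last (λ k → f (toℕ k)) ⟩
    sum {n} (λ k → f (toℕ (Fin.inject₁ k))) + f (toℕ (Fin.fromℕ n))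
      ≈⟨ +-cong (sum-cong-≋ {n} (λ k → reflexive (≡.cong f (toℕ-inject₁ k))))
                (trans (reflexive (≡.cong f (toℕ-fromℕ n))) fn≈0) ⟩
    sumTo n f + 0#
      ≈⟨ +-identityʳ _ ⟩
    sumTo n f ∎

  sumTo-δ : ∀ {n i} (f : Row) → i < n → sumTo n (λ k → δ i k * f k) ≈ f i
  sumTo-δ {suc n} {zero} f _ = begin
    1# * f 0 + sumTo n (λ k → 0# * f (suc k))
      ≈⟨ +-cong (*-identityˡ (f 0)) (sum-cong-≋ {n} (λ k → zeroˡ (f (suc (toℕ k))))) ⟩
    f 0 + sum {n} (λ _ → 0#)
      ≈⟨ +-congˡ (sum-replicate-zero n) ⟩
    f 0 + 0#
      ≈⟨ +-identityʳ _ ⟩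
    f 0 ∎
  sumTo-δ {suc n} {suc i} f (s≤s i<n) =
    trans (+-cong (zeroˡ _) (sumTo-δ (λ k → f (suc k)) i<n)) (+-identityˡ _)

  sumTo-shift : ∀ n (g : Row) (B : ℕ → Row) j →
    sumTo n (λ k → g k * shift (B k) j) ≈ shift (λ j → sumTo n (λ k → g k * B k j)) j
  sumTo-shift n g B zero    =
    trans (sum-cong-≋ {n} (λ k → zeroʳ (g (toℕ k)))) (sum-replicate-zero n)
  sumTo-shift n g B (suc j) = refl

  sumTo-mulLinear : ∀ n a b (g : Row) (B : ℕ → Row) j →
    sumTo n (λ k → g k * mulLinear a b (B k) j) ≈ mulLinear a b (λ j → sumTo n (λ k → g k * B k j)) j
  sumTo-mulLinear n a b g B j = begin
    sumTo n (λ k → g k * mulLinear a b (B k) j)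
      ≈⟨ sumTo-cong n (λ k _ → *-linear a b (B k j) (shift (B k) j) (g k)) ⟩
    sumTo n (λ k → a * (g k * B k j) + b * (g k * shift (B k) j))
      ≈⟨ sumTo-linear n a b (λ k → g k * B k j) (λ k → g k * shift (B k) j) ⟩
    a * sumTo n (λ k → g k * B k j) + b * sumTo n (λ k → g k * shift (B k) j)
      ≈⟨ +-congˡ (*-congˡ (sumTo-shift n g B j)) ⟩
    mulLinear a b (λ j → sumTo n (λ k → g k * B k j)) j ∎

  -- A m is an (m+1)×(m+1) matrix, only its entries A m i j with i, j ≤ m matter.
  Family : Set c
  Family = ℕ → ℕ → ℕ → Carrier

  infixl 7 _⊙_
  _⊙_ : Family → Family → Family
  (A ⊙ B) m i j = sumTo (suc m) (λ k → A m i k * B m k j)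

  infix 4 _≈ᶠ_
  _≈ᶠ_ : Family → Family → Set ℓ
  A ≈ᶠ B = ∀ m i → i ≤ m → ∀ j → A m i j ≈ B m i j

  Δ : Family
  Δ _ i j = δ i j

  RowRecurrence : Carrier → Carrier → Family → Set ℓ
  RowRecurrence a b A = ∀ m i → i ≤ m → ∀ j → A (suc m) i j ≈ mulLinear a b (A m i) j

  ShiftRecurrence : Carrier → Carrier → Family → Set ℓ
  ShiftRecurrence a b A = ∀ m k → k ≤ m → ∀ j → A (suc m) (suc k) j ≈ mulLinear a b (A m k) j

  ZeroPastSize : Family → Set ℓ
  ZeroPastSize A = ∀ m i → i ≤ m → A m i (suc m) ≈ 0#

  rowRecurrence-resp : ∀ {a a′ b b′ A} → a ≈ a′ → b ≈ b′ →
                       RowRecurrence a b A → RowRecurrence a′ b′ A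
  rowRecurrence-resp a≈a′ b≈b′ rec m i i≤m j =
    trans (rec m i i≤m j) (mulLinear-cong a≈a′ b≈b′ (λ _ → refl) j)

  Δ-rowRecurrence : RowRecurrence 1# 0# Δ
  Δ-rowRecurrence m i _ j = sym (mulLinear-identity (δ i) j)

  -- As maps of row polynomials, B (m+1) sends xᵏ to (a₃ + a₄ x) · (row k of B m) and xᵏ⁺¹ to
  -- (a₅ + a₆ x) · (row k of B m); hence it sends (a₁ + a₂ x) · f to (a₁ (a₃ + a₄ x) + a₂ (a₅ + a₆ x)) · (f B m).
  -- ZeroPastSize A says that f has no term xᵐ⁺¹.
  ⊙-rowRecurrence : ∀ {a₁ a₂ a₃ a₄ a₅ a₆ A B} →
    RowRecurrence a₁ a₂ A → ZeroPastSize A → RowRecurrence a₃ a₄ B → ShiftRecurrence a₅ a₆ B →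
    RowRecurrence (a₁ * a₃ + a₂ * a₅) (a₁ * a₄ + a₂ * a₆) (A ⊙ B)
  ⊙-rowRecurrence {a₁} {a₂} {a₃} {a₄} {a₅} {a₆} {A} {B} recA zeroA recB shiftB m i i≤m j = begin
    sumTo (suc (suc m)) (λ k → A (suc m) i k * B′ k)
      ≈⟨ sumTo-cong (suc (suc m))
           (λ k _ → trans (*-congʳ (recA m i i≤m k)) (linear-*ʳ a₁ a₂ (f k) (shift f k) (B′ k))) ⟩
    sumTo (suc (suc m)) (λ k → a₁ * (f k * B′ k) + a₂ * (shift f k * B′ k))
      ≈⟨ sumTo-linear (suc (suc m)) a₁ a₂ (λ k → f k * B′ k) (λ k → shift f k * B′ k) ⟩
    a₁ * sumTo (suc (suc m)) (λ k → f k * B′ k) + a₂ * sumTo (suc (suc m)) (λ k → shift f k * B′ k)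
      ≈⟨ +-cong (*-congˡ unshifted) (*-congˡ shifted) ⟩
    a₁ * mulLinear a₃ a₄ h j + a₂ * mulLinear a₅ a₆ h j
      ≈⟨ mulLinear-combination a₁ a₂ a₃ a₄ a₅ a₆ h j ⟩
    mulLinear (a₁ * a₃ + a₂ * a₅) (a₁ * a₄ + a₂ * a₆) h j ∎
    where
      f : Row
      f = A m i
      B′ : Row
      B′ k = B (suc m) k j
      h : Row
      h = (A ⊙ B) m i

      unshifted : sumTo (suc (suc m)) (λ k → f k * B′ k) ≈ mulLinear a₃ a₄ h j
      unshifted = begin
        sumTo (suc (suc m)) (λ k → f k * B′ k)
          ≈⟨ sumTo-last-zero (suc m) (λ k → f k * B′ k)
               (trans (*-congʳ (zeroA m i i≤m)) (zeroˡ (B′ (suc m)))) ⟩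
        sumTo (suc m) (λ k → f k * B′ k)
          ≈⟨ sumTo-cong (suc m) (λ k k≤m → *-congˡ {f k} (recB m k (ℕₚ.≤-pred k≤m) j)) ⟩
        sumTo (suc m) (λ k → f k * mulLinear a₃ a₄ (B m k) j)
          ≈⟨ sumTo-mulLinear (suc m) a₃ a₄ f (B m) j ⟩
        mulLinear a₃ a₄ h j ∎

      shifted : sumTo (suc (suc m)) (λ k → shift f k * B′ k) ≈ mulLinear a₅ a₆ h j
      shifted = begin
        0# * B′ 0 + sumTo (suc m) (λ k → f k * B′ (suc k))
          ≈⟨ trans (+-congʳ (zeroˡ _)) (+-identityˡ _) ⟩
        sumTo (suc m) (λ k → f k * B′ (suc k))
          ≈⟨ sumTo-cong (suc m) (λ k k≤m → *-congˡ {f k} (shiftB m k (ℕₚ.≤-pred k≤m) j)) ⟩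
        sumTo (suc m) (λ k → f k * mulLinear a₅ a₆ (B m k) j)
          ≈⟨ sumTo-mulLinear (suc m) a₅ a₆ f (B m) j ⟩
        mulLinear a₅ a₆ h j ∎

  rowRecurrence-unique : ∀ {a b A B} → RowRecurrence a b A → RowRecurrence a b B →
    (∀ m j → A m m j ≈ B m m j) → A ≈ᶠ B
  rowRecurrence-unique recA recB diag zero zero z≤n j = diag zero j
  rowRecurrence-unique {a} {b} {A} {B} recA recB diag (suc m) i i≤1+m j
    with ℕₚ.m≤n⇒m<n∨m≡n i≤1+m
  ... | inj₂ ≡.refl    = diag (suc m) j
  ... | inj₁ (s≤s i≤m) = begin
    A (suc m) i j            ≈⟨ recA m i i≤m j ⟩
    mulLinear a b (A m i) j  ≈⟨ mulLinear-cong refl refl (rowRecurrence-unique recA recB diag m i i≤m) j ⟩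
    mulLinear a b (B m i) j  ≈⟨ recB m i i≤m j ⟨
    B (suc m) i j            ∎

  ⊙-congˡ : ∀ A {B B′} → B ≈ᶠ B′ → ∀ m i j → (A ⊙ B) m i j ≈ (A ⊙ B′) m i j
  ⊙-congˡ A B≈B′ m i j =
    sumTo-cong (suc m) (λ k k≤m → *-congˡ {A m i k} (B≈B′ m k (ℕₚ.≤-pred k≤m) j))

  ⊙-congʳ : ∀ {A A′} B → A ≈ᶠ A′ → A ⊙ B ≈ᶠ A′ ⊙ B
  ⊙-congʳ B A≈A′ m i i≤m j = sumTo-cong (suc m) (λ k _ → *-congʳ {B m k j} (A≈A′ m i i≤m k))

  ⊙-assoc : ∀ A B D m i j → (A ⊙ B ⊙ D) m i j ≈ (A ⊙ (B ⊙ D)) m i j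
  ⊙-assoc A B D m i j = begin
    sumTo n (λ k → sumTo n (λ l → A m i l * B m l k) * D m k j)
      ≈⟨ sumTo-cong n (λ k _ →
           trans (*-distribʳ-sum {n} (D m k j) (λ l → A m i (toℕ l) * B m (toℕ l) k))
                 (sumTo-cong n (λ l _ → *-assoc (A m i l) (B m l k) (D m k j)))) ⟩
    sumTo n (λ k → sumTo n (λ l → A m i l * (B m l k * D m k j)))
      ≈⟨ ∑-comm {n} {n} (λ k l → A m i (toℕ l) * (B m (toℕ l) (toℕ k) * D m (toℕ k) j)) ⟩
    sumTo n (λ l → sumTo n (λ k → A m i l * (B m l k * D m k j)))
      ≈⟨ sumTo-cong n (λ l _ →
           sym (*-distribˡ-sum {n} (A m i l) (λ k → B m l (toℕ k) * D m (toℕ k) j))) ⟩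
    sumTo n (λ l → A m i l * sumTo n (λ k → B m l k * D m k j)) ∎
    where
      n : ℕ
      n = suc m

  ⊙-unitDiagonal : ∀ A B → (∀ m j → A m m j ≈ δ m j) → ∀ m j → (A ⊙ B) m m j ≈ B m m j
  ⊙-unitDiagonal A B diag m j = begin
    sumTo (suc m) (λ k → A m m k * B m k j)
      ≈⟨ sumTo-cong (suc m) (λ k _ → *-congʳ {B m k j} (diag m k)) ⟩
    sumTo (suc m) (λ k → δ m k * B m k j)
      ≈⟨ sumTo-δ (λ k → B m k j) (s≤s ℕₚ.≤-refl) ⟩
    B m m j ∎

  ⊙-conjugate : ∀ {P P⁻¹ L T} → P⁻¹ ⊙ P ≈ᶠ Δ → L ⊙ P ≈ᶠ P ⊙ T → P⁻¹ ⊙ L ⊙ P ≈ᶠ T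
  ⊙-conjugate {P} {P⁻¹} {L} {T} P⁻¹P≈Δ LP≈PT m i i≤m j = begin
    (P⁻¹ ⊙ L ⊙ P) m i j    ≈⟨ ⊙-assoc P⁻¹ L P m i j ⟩
    (P⁻¹ ⊙ (L ⊙ P)) m i j  ≈⟨ ⊙-congˡ P⁻¹ LP≈PT m i j ⟩
    (P⁻¹ ⊙ (P ⊙ T)) m i j  ≈⟨ ⊙-assoc P⁻¹ P T m i j ⟨
    (P⁻¹ ⊙ P ⊙ T) m i j    ≈⟨ ⊙-congʳ T P⁻¹P≈Δ m i i≤m j ⟩
    (Δ ⊙ T) m i j          ≈⟨ sumTo-δ (λ k → T m k j) (s≤s i≤m) ⟩
    T m i j                ∎

  -- Row i of the m-th matrix is xⁱ (1 + a x)^(m ∸ i).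
  binomialFamily : Carrier → Family
  binomialFamily a m i j = fromℕ R (binomDiff R (m ∸ i) j i) * pow R a (j ∸ i)

  record IsBinomialFamily (a : Carrier) (A : Family) : Set ℓ where
    field
      rowRecurrence   : RowRecurrence 1# a A
      shiftRecurrence : ShiftRecurrence 0# 1# A
      zeroPastSize    : ZeroPastSize A
      unitDiagonal    : ∀ m j → A m m j ≈ δ m j

  open IsBinomialFamily

  isBinomialFamily-resp : ∀ {a A B} → (∀ m i j → A m i j ≈ B m i j) →
                          IsBinomialFamily a A → IsBinomialFamily a B
  isBinomialFamily-resp A≈B isA = record
    { rowRecurrence   = λ m i i≤m j →
        trans (sym (A≈B (suc m) i j))
              (trans (rowRecurrence isA m i i≤m j) (mulLinear-cong refl refl (A≈B m i) j))
    ; shiftRecurrence = λ m k k≤m j →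
        trans (sym (A≈B (suc m) (suc k) j))
              (trans (shiftRecurrence isA m k k≤m j) (mulLinear-cong refl refl (A≈B m k) j))
    ; zeroPastSize    = λ m i i≤m → trans (sym (A≈B m i (suc m))) (zeroPastSize isA m i i≤m)
    ; unitDiagonal    = λ m j → trans (sym (A≈B m m j)) (unitDiagonal isA m j)
    }

  binomDiff-*-pow-suc : ∀ a n i j → fromℕ R (binomDiff R n j i) * pow R a (suc j ∸ i) ≈
                                     a * (fromℕ R (binomDiff R n j i) * pow R a (j ∸ i))
  binomDiff-*-pow-suc a n i j = *-pow-suc a (fromℕ R (binomDiff R n j i)) {suc j ∸ i} {j ∸ i} exponent-or-zero
    where
      exponent-or-zero : suc j ∸ i ≡ suc (j ∸ i) ⊎ fromℕ R (binomDiff R n j i) ≈ 0#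
      exponent-or-zero with i ℕₚ.≤? j
      ... | yes i≤j = inj₁ (ℕₚ.+-∸-assoc 1 i≤j)
      ... | no i≰j  = inj₂ (reflexive (≡.cong (fromℕ R) (binomDiff-< n (ℕₚ.≰⇒> i≰j))))

  binomialFamily-pascal : ∀ a n i j →
    fromℕ R (binomDiff R (suc n) j i) * pow R a (j ∸ i) ≈
    mulLinear 1# a (λ j → fromℕ R (binomDiff R n j i) * pow R a (j ∸ i)) j
  binomialFamily-pascal a n i zero = begin
    fromℕ R (binomDiff R (suc n) 0 i) * pow R a (0 ∸ i)
      ≡⟨ ≡.cong (λ b → fromℕ R b * pow R a (0 ∸ i)) (binomDiff-pascal₀ n i) ⟩
    fromℕ R (binomDiff R n 0 i) * pow R a (0 ∸ i)
      ≈⟨ trans (+-cong (*-identityˡ _) (zeroʳ a)) (+-identityʳ _) ⟨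
    1# * (fromℕ R (binomDiff R n 0 i) * pow R a (0 ∸ i)) + a * 0# ∎
  binomialFamily-pascal a n i (suc j) = begin
    fromℕ R (binomDiff R (suc n) (suc j) i) * pow R a (suc j ∸ i)
      ≈⟨ *-congʳ (trans (reflexive (≡.cong (fromℕ R) (binomDiff-pascal n j i)))
                        (fromℕ-+ (binomDiff R n (suc j) i) (binomDiff R n j i))) ⟩
    (fromℕ R (binomDiff R n (suc j) i) + fromℕ R (binomDiff R n j i)) * pow R a (suc j ∸ i)
      ≈⟨ distribʳ _ _ _ ⟩
    fromℕ R (binomDiff R n (suc j) i) * pow R a (suc j ∸ i) +
    fromℕ R (binomDiff R n j i) * pow R a (suc j ∸ i)
      ≈⟨ +-cong (sym (*-identityˡ _)) (binomDiff-*-pow-suc a n i j) ⟩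
    1# * (fromℕ R (binomDiff R n (suc j) i) * pow R a (suc j ∸ i)) +
    a * (fromℕ R (binomDiff R n j i) * pow R a (j ∸ i)) ∎

  binomDiff-zero-*-pow : ∀ a i j → fromℕ R (binomDiff R 0 j i) * pow R a (j ∸ i) ≈ δ i j
  binomDiff-zero-*-pow a zero    zero    = trans (*-identityʳ _) (+-identityʳ 1#)
  binomDiff-zero-*-pow a zero    (suc j) = zeroˡ _
  binomDiff-zero-*-pow a (suc i) zero    = zeroˡ _
  binomDiff-zero-*-pow a (suc i) (suc j) =
    trans (*-congʳ (reflexive (≡.cong (fromℕ R) (binomDiff-suc-suc 0 j i)))) (binomDiff-zero-*-pow a i j)

  binomialFamily-isBinomialFamily : ∀ a → IsBinomialFamily a (binomialFamily a)
  binomialFamily-isBinomialFamily a = record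
    { rowRecurrence   = λ m i i≤m j →
        trans (reflexive (≡.cong (λ n → fromℕ R (binomDiff R n j i) * pow R a (j ∸ i))
                                 (ℕₚ.+-∸-assoc 1 i≤m)))
              (binomialFamily-pascal a (m ∸ i) i j)
    ; shiftRecurrence = λ m k _ j → trans (shifted m k j) (sym (mulLinear-x _ j))
    ; zeroPastSize    = λ m i i≤m →
        trans (*-congʳ (reflexive (≡.cong (fromℕ R) (vanishes m i i≤m)))) (zeroˡ _)
    ; unitDiagonal    = λ m j →
        trans (*-congʳ (reflexive (≡.cong (λ n → fromℕ R (binomDiff R n j m)) (ℕₚ.n∸n≡0 m))))
              (binomDiff-zero-*-pow a m j)
    }
    where
      shifted : ∀ m k j → binomialFamily a (suc m) (suc k) j ≈ shift (binomialFamily a m k) j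
      shifted m k zero    = zeroˡ _
      shifted m k (suc j) = *-congʳ (reflexive (≡.cong (fromℕ R) (binomDiff-suc-suc (m ∸ k) j k)))

      vanishes : ∀ m i → i ≤ m → binomDiff R (m ∸ i) (suc m) i ≡ 0
      vanishes m i i≤m =
        ≡.trans (binomDiff-≤ (m ∸ i) (ℕₚ.m≤n⇒m≤1+n i≤m))
                (≡.trans (≡.cong ((m ∸ i) C_) (ℕₚ.+-∸-assoc 1 i≤m)) (k>n⇒nCk≡0 (ℕₚ.n<1+n (m ∸ i))))

  P : Family
  P m i j = fromℕ R (binomDiff R (m ∸ i) j i)

  P⁻¹ : Family
  P⁻¹ = binomialFamily (- 1#)

  P-isBinomialFamily : IsBinomialFamily 1# P
  P-isBinomialFamily =
    isBinomialFamily-resp (λ m i j → trans (*-congˡ (pow-1# (j ∸ i))) (*-identityʳ _))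
                          (binomialFamily-isBinomialFamily 1#)

  ⊙-inverse : ∀ {a b A B} → a + b ≈ 0# → IsBinomialFamily a A → IsBinomialFamily b B → A ⊙ B ≈ᶠ Δ
  ⊙-inverse {a} {b} {A} {B} a+b≈0 isA isB = rowRecurrence-unique recurrence Δ-rowRecurrence diagonal
    where
      recurrence : RowRecurrence 1# 0# (A ⊙ B)
      recurrence =
        rowRecurrence-resp (trans (+-cong (*-identityʳ 1#) (zeroʳ a)) (+-identityʳ 1#))
                           (trans (+-cong (*-identityˡ b) (*-identityʳ a)) (trans (+-comm b a) a+b≈0))
                           (⊙-rowRecurrence (rowRecurrence isA) (zeroPastSize isA)
                                            (rowRecurrence isB) (shiftRecurrence isB))

      diagonal : ∀ m j → (A ⊙ B) m m j ≈ δ m j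
      diagonal m j = trans (⊙-unitDiagonal A B (unitDiagonal isA) m j) (unitDiagonal isB m j)

  P⊙P⁻¹≈Δ : P ⊙ P⁻¹ ≈ᶠ Δ
  P⊙P⁻¹≈Δ = ⊙-inverse (-‿inverseʳ 1#) P-isBinomialFamily (binomialFamily-isBinomialFamily (- 1#))

  P⁻¹⊙P≈Δ : P⁻¹ ⊙ P ≈ᶠ Δ
  P⁻¹⊙P≈Δ = ⊙-inverse (-‿inverseˡ 1#) (binomialFamily-isBinomialFamily (- 1#)) P-isBinomialFamily

  -- The coefficients of (p + x)ⁿ.
  binomialRow : Carrier → ℕ → Row
  binomialRow p n j = fromℕ R (n C j) * pow R p (n ∸ j)

  C[1+j]-*-pow : ∀ p n j →
    fromℕ R (n C suc j) * pow R p (n ∸ j) ≈ p * (fromℕ R (n C suc j) * pow R p (n ∸ suc j))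
  C[1+j]-*-pow p n j = *-pow-suc p (fromℕ R (n C suc j)) {n ∸ j} {n ∸ suc j} (exponent-or-zero n)
    where
      exponent-or-zero : ∀ n → n ∸ j ≡ suc (n ∸ suc j) ⊎ fromℕ R (n C suc j) ≈ 0#
      exponent-or-zero n with suc j ℕₚ.≤? n
      ... | yes (s≤s j≤n) = inj₁ (ℕₚ.+-∸-assoc 1 j≤n)
      ... | no 1+j≰n      = inj₂ (reflexive (≡.cong (fromℕ R) (k>n⇒nCk≡0 (ℕₚ.≰⇒> 1+j≰n))))

  binomialRow-suc : ∀ p n j → binomialRow p (suc n) j ≈ mulLinear p 1# (binomialRow p n) j
  binomialRow-suc p n zero =
    trans (x∙yz≈y∙xz _ p _) (sym (trans (+-congˡ (zeroʳ 1#)) (+-identityʳ _)))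
  binomialRow-suc p n (suc j) = begin
    fromℕ R (suc n C suc j) * pow R p (n ∸ j)
      ≈⟨ *-congʳ (trans (reflexive (≡.cong (fromℕ R) (≡.sym (nCk+nC[k+1]≡[n+1]C[k+1] n j))))
                        (fromℕ-+ (n C j) (n C suc j))) ⟩
    (fromℕ R (n C j) + fromℕ R (n C suc j)) * pow R p (n ∸ j)
      ≈⟨ distribʳ _ _ _ ⟩
    binomialRow p n j + fromℕ R (n C suc j) * pow R p (n ∸ j)
      ≈⟨ +-congˡ (C[1+j]-*-pow p n j) ⟩
    binomialRow p n j + p * binomialRow p n (suc j)
      ≈⟨ trans (+-comm _ _) (+-congˡ (sym (*-identityˡ _))) ⟩
    p * binomialRow p n (suc j) + 1# * binomialRow p n j ∎

  L : Carrier → Carrier → Family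
  L p q _ i j = fromℕ R (binomDiff R i i j) * (pow R p (i ∸ j) * pow R q (suc j))

  T : Carrier → Carrier → Family
  T p q m i j = fromℕ R (i C j) * (pow R p (i ∸ j) * pow R q (suc m ∸ i))

  L-rowRecurrence : ∀ {p q} → RowRecurrence 1# 0# (L p q)
  L-rowRecurrence m i _ j = sym (mulLinear-identity _ j)

  L-zeroPastSize : ∀ {p q} → ZeroPastSize (L p q)
  L-zeroPastSize m i i≤m =
    trans (*-congʳ (reflexive (≡.cong (fromℕ R) (binomDiff-< i (s≤s i≤m))))) (zeroˡ _)

  L-diagonal : ∀ p q m j → L p q m m j ≈ binomialRow p m j * pow R q (suc j)
  L-diagonal p q m j =
    trans (*-congʳ (reflexive (≡.cong (fromℕ R) (binomDiff-diagonal m j)))) (sym (*-assoc _ _ _))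

  L-diagonal-suc : ∀ p q m j → L p q (suc m) (suc m) j ≈ mulLinear p q (L p q m m) j
  L-diagonal-suc p q m j = begin
    L p q (suc m) (suc m) j                              ≈⟨ L-diagonal p q (suc m) j ⟩
    binomialRow p (suc m) j * pow R q (suc j)            ≈⟨ *-congʳ (binomialRow-suc p m j) ⟩
    mulLinear p 1# (binomialRow p m) j * pow R q (suc j)
      ≈⟨ mulLinear-*-geometric p 1# q (binomialRow p m) (λ j → pow R q (suc j)) (λ _ → refl) j ⟩
    mulLinear p (1# * q) (λ j → binomialRow p m j * pow R q (suc j)) j
      ≈⟨ mulLinear-cong refl (*-identityˡ q) (λ j → sym (L-diagonal p q m j)) j ⟩
    mulLinear p q (L p q m m) j                          ∎

  T-rowRecurrence : ∀ {p q} → RowRecurrence q 0# (T p q)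
  T-rowRecurrence {p} {q} m k k≤m j = begin
    fromℕ R (k C j) * (pow R p (k ∸ j) * pow R q (suc (suc m) ∸ k))
      ≡⟨ ≡.cong (λ e → fromℕ R (k C j) * (pow R p (k ∸ j) * pow R q e))
                (ℕₚ.+-∸-assoc 1 (ℕₚ.m≤n⇒m≤1+n k≤m)) ⟩
    fromℕ R (k C j) * (pow R p (k ∸ j) * (q * pow R q (suc m ∸ k)))
      ≈⟨ trans (*-congˡ (x∙yz≈y∙xz _ q _)) (x∙yz≈y∙xz _ q _) ⟩
    q * T p q m k j
      ≈⟨ trans (+-congˡ (zeroˡ _)) (+-identityʳ _) ⟨
    mulLinear q 0# (T p q m k) j ∎

  T-shiftRecurrence : ∀ {p q} → ShiftRecurrence p 1# (T p q)
  T-shiftRecurrence {p} {q} m k _ j = begin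
    T p q (suc m) (suc k) j                 ≈⟨ *-assoc _ _ _ ⟨
    binomialRow p (suc k) j * Y              ≈⟨ *-congʳ (binomialRow-suc p k j) ⟩
    mulLinear p 1# (binomialRow p k) j * Y
      ≈⟨ mulLinear-*-geometric p 1# 1# (binomialRow p k) (λ _ → Y) (λ _ → sym (*-identityˡ Y)) j ⟩
    mulLinear p (1# * 1#) (λ j → binomialRow p k j * Y) j
      ≈⟨ mulLinear-cong refl (*-identityˡ 1#) (λ j → *-assoc _ _ _) j ⟩
    mulLinear p 1# (T p q m k) j             ∎
    where
      Y : Carrier
      Y = pow R q (suc m ∸ k)

  -- The last rows of L satisfy a recurrence of their own, which drives an induction on m.
  L⊙P-diagonal : ∀ {p q} → p + q ≈ 1# → ∀ m j → (L p q ⊙ P) m m j ≈ T p q m m j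
  L⊙P-diagonal p+q≈1 zero zero =
    trans (+-identityʳ _) (trans (*-congˡ (+-identityʳ 1#)) (*-identityʳ _))
  L⊙P-diagonal p+q≈1 zero (suc j) =
    trans (+-identityʳ _) (trans (zeroʳ _) (sym (zeroˡ _)))
  L⊙P-diagonal {p} {q} p+q≈1 (suc m) j = begin
    (lastRow ⊙ P) (suc m) 0 j             ≈⟨ recurrence m 0 z≤n j ⟩
    mulLinear p 1# ((lastRow ⊙ P) m 0) j  ≈⟨ mulLinear-cong refl refl (L⊙P-diagonal p+q≈1 m) j ⟩
    mulLinear p 1# (T p q m m) j          ≈⟨ T-shiftRecurrence m m ℕₚ.≤-refl j ⟨
    T p q (suc m) (suc m) j               ∎
    where
      lastRow : Family
      lastRow m _ = L p q m m

      recurrence : RowRecurrence p 1# (lastRow ⊙ P)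
      recurrence =
        rowRecurrence-resp (trans (+-cong (*-identityʳ p) (zeroʳ q)) (+-identityʳ p))
                           (trans (+-cong (*-identityʳ p) (*-identityʳ q)) p+q≈1)
                           (⊙-rowRecurrence (λ m _ _ → L-diagonal-suc p q m)
                                            (λ m _ _ → L-zeroPastSize m m ℕₚ.≤-refl)
                                            (rowRecurrence P-isBinomialFamily)
                                            (shiftRecurrence P-isBinomialFamily))

  L⊙P≈P⊙T : ∀ {p q} → p + q ≈ 1# → L p q ⊙ P ≈ᶠ P ⊙ T p q
  L⊙P≈P⊙T {p} {q} p+q≈1 = rowRecurrence-unique recurrenceL recurrenceT diagonal
    where
      recurrenceL : RowRecurrence 1# 1# (L p q ⊙ P)
      recurrenceL =
        rowRecurrence-resp (trans (+-cong (*-identityʳ 1#) (zeroʳ 0#)) (+-identityʳ 1#))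
                           (trans (+-cong (*-identityʳ 1#) (zeroˡ 1#)) (+-identityʳ 1#))
                           (⊙-rowRecurrence L-rowRecurrence L-zeroPastSize
                                            (rowRecurrence P-isBinomialFamily) (shiftRecurrence P-isBinomialFamily))

      recurrenceT : RowRecurrence 1# 1# (P ⊙ T p q)
      recurrenceT =
        rowRecurrence-resp (trans (+-cong (*-identityˡ q) (*-identityˡ p)) (trans (+-comm q p) p+q≈1))
                           (trans (+-cong (zeroʳ 1#) (*-identityˡ 1#)) (+-identityˡ 1#))
                           (⊙-rowRecurrence (rowRecurrence P-isBinomialFamily) (zeroPastSize P-isBinomialFamily)
                                            T-rowRecurrence T-shiftRecurrence)

      diagonal : ∀ m j → (L p q ⊙ P) m m j ≈ (P ⊙ T p q) m m j
      diagonal m j = trans (L⊙P-diagonal p+q≈1 m j)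
                           (sym (⊙-unitDiagonal P (T p q) (unitDiagonal P-isBinomialFamily) m j))

  P⁻¹⊙L⊙P≈T : ∀ {p q} → p + q ≈ 1# → P⁻¹ ⊙ L p q ⊙ P ≈ᶠ T p q
  P⁻¹⊙L⊙P≈T {p} {q} p+q≈1 = ⊙-conjugate {P} {P⁻¹} {L p q} {T p q} P⁻¹⊙P≈Δ (L⊙P≈P⊙T p+q≈1)

  toMat : Family → (m : ℕ) → Mat R m
  toMat A m i j = A m (toℕ i) (toℕ j)

  ∑≡sum : ∀ {n} (f : Fin n → Carrier) → ∑ R f ≡ sum f
  ∑≡sum {zero}  f = ≡.refl
  ∑≡sum {suc n} f = ≡.cong (f Fin.zero +_) (∑≡sum (λ k → f (Fin.suc k)))

  toMat-⊙ : ∀ {A B D} → A ⊙ B ≈ᶠ D → ∀ m → _≋_ R (_⊗_ R (toMat A m) (toMat B m)) (toMat D m)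
  toMat-⊙ {A} {B} AB≈D m i j =
    trans (reflexive (∑≡sum (λ k → toMat A m i k * toMat B m k j)))
          (AB≈D m (toℕ i) (toℕ≤pred[n] i) (toℕ j))

  toMat-⊙⊙ : ∀ {A B D E} → A ⊙ B ⊙ D ≈ᶠ E → ∀ m →
    _≋_ R (_⊗_ R (_⊗_ R (toMat A m) (toMat B m)) (toMat D m)) (toMat E m)
  toMat-⊙⊙ {A} {B} {D} {E} ABD≈E m i j = begin
    ∑ R (λ k → AB k * toMat D m k j)
      ≡⟨ ∑≡sum (λ k → AB k * toMat D m k j) ⟩
    sum (λ k → AB k * toMat D m k j)
      ≈⟨ sum-cong-≋ {suc m} (λ k →
           *-congʳ {toMat D m k j} (reflexive (∑≡sum (λ l → toMat A m i l * toMat B m l k)))) ⟩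
    (A ⊙ B ⊙ D) m (toℕ i) (toℕ j)
      ≈⟨ ABD≈E m (toℕ i) (toℕ≤pred[n] i) (toℕ j) ⟩
    E m (toℕ i) (toℕ j) ∎
    where
      AB : Fin (suc m) → Carrier
      AB k = _⊗_ R (toMat A m) (toMat B m) i k

lemma2 : {c ℓ : Level} (R : CommutativeRing c ℓ) (p : CommutativeRing.Carrier R) (m : ℕ) → 1 ≤ m →
    Σ (Mat R m) (λ Pinv →
      (_≋_ R (_⊗_ R (Pmat R m) Pinv) (Id R m)) ×
      (_≋_ R (_⊗_ R Pinv (Pmat R m)) (Id R m)) ×
      (_≋_ R (_⊗_ R (_⊗_ R Pinv (Lmat R m p (CommutativeRing._-_ R (CommutativeRing.1# R) p))) (Pmat R m))
             (Tmat R m p (CommutativeRing._-_ R (CommutativeRing.1# R) p))))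
lemma2 R p m _ =
  toMat R (P⁻¹ R) m ,
  toMat-⊙ R {P R} {P⁻¹ R} {Δ R} (P⊙P⁻¹≈Δ R) m ,
  toMat-⊙ R {P⁻¹ R} {P R} {Δ R} (P⁻¹⊙P≈Δ R) m ,
  toMat-⊙⊙ R {P⁻¹ R} {L R p (1# - p)} {P R} {T R p (1# - p)} (P⁻¹⊙L⊙P≈T R p+[1-p]≈1) m
  where
    open CommutativeRing R
      using (_≈_; _+_; _-_; -_; 1#; trans; +-comm; +-assoc; +-congˡ; -‿inverseˡ; +-identityʳ)

    p+[1-p]≈1 : p + (1# - p) ≈ 1#
    p+[1-p]≈1 =
      trans (+-comm p (1# - p)) (trans (+-assoc 1# (- p) p) (trans (+-congˡ (-‿inverseˡ p)) (+-identityʳ 1#)))
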